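{- Let $D$ be a minimal strong digraph, let $C_q$ be a directed cycle of length $q\ge 2$ contained in $D$, and let $D'$ be the digraph obtained from $D$ by deleting all arcs of $C_q$. If $C$ is a directed cycle in $D$ none of whose vertices is a linear vertex of $D$, then $C$ is not a strong component of $D'$.
   Context: An arc $uv$ of a digraph is transitive if there is another directed $uv$-path not using the arc $uv$. A minimal strong digraph is a strongly connected digraph with no transitive arcs. A strong component is a maximal strongly connected subdigraph. A vertex $v$ of $D$ is linear if its indegree and outdegree in $D$ are both equal to $1$. -}

module Defs where

open import Data.Nat using (ℕ; zero; suc; _+_; _%_)
open import Data.Nat.DivMod using (m%n<n)
open import Data.Fin using (Fin; toℕ; fromℕ<)
open import Data.Bool using (Bool; true; false)
open import Data.List using (List; []; _∷_; length; filterᵇ; allFin)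
open import Data.List.Relation.Unary.Unique.Propositional using (Unique)
open import Data.Product using (Σ; ∃; _×_; _,_)
open import Function using (Injective)
open import Relation.Binary.PropositionalEquality using (_≡_)
open import Relation.Nullary using (¬_)
open import Level using (Level; 0ℓ)

record Digraph : Set where
  field
    n        : ℕ
    adj      : Fin n → Fin n → Bool
    loopless : ∀ v → adj v v ≡ false

open Digraph public

Vertex : Digraph → Set
Vertex D = Fin (n D)

Arc : (D : Digraph) → Vertex D → Vertex D → Set
Arc D u v = adj D u v ≡ true

data Walk {V : Set} (R : V → V → Set) : V → V → Set where
  []  : ∀ {u} → Walk R u u
  _∷_ : ∀ {u v w} → R u v → Walk R v w → Walk R u w

verts : ∀ {V : Set} {R : V → V → Set} {u v : V} → Walk R u v → List V
verts {u = u} []      = u ∷ []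
verts {u = u} (_ ∷ p) = u ∷ verts p

Path : {V : Set} → (V → V → Set) → V → V → Set
Path R u v = Σ (Walk R u v) (λ p → Unique (verts p))

StronglyConnected : Digraph → Set
StronglyConnected D = ∀ u v → Path (Arc D) u v

ArcWithout : (D : Digraph) → Vertex D → Vertex D → Vertex D → Vertex D → Set
ArcWithout D u v x y = Arc D x y × ¬ (x ≡ u × y ≡ v)

TransitiveArc : (D : Digraph) → Vertex D → Vertex D → Set
TransitiveArc D u v = Arc D u v × Path (ArcWithout D u v) u v

MinimalStrong : Digraph → Set
MinimalStrong D = StronglyConnected D × (∀ u v → ¬ TransitiveArc D u v)

outdeg : (D : Digraph) → Vertex D → ℕ
outdeg D v = length (filterᵇ (λ w → adj D v w) (allFin (n D)))

indeg : (D : Digraph) → Vertex D → ℕ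
indeg D v = length (filterᵇ (λ w → adj D w v) (allFin (n D)))

Linear : (D : Digraph) → Vertex D → Set
Linear D v = indeg D v ≡ 1 × outdeg D v ≡ 1

next : ∀ {q} .{{_ : Data.Nat.NonZero q}} → Fin q → Fin q
next {q} i = fromℕ< (m%n<n (suc (toℕ i)) q)

record Cycle (D : Digraph) : Set where
  field
    k      : ℕ
    vtx    : Fin (2 + k) → Vertex D
    vtxInj : Injective _≡_ _≡_ vtx
    arcs   : ∀ i → Arc D (vtx i) (vtx (next i))

open Cycle public

len : ∀ {D} → Cycle D → ℕ
len C = 2 + k C

CycleVerts : ∀ {D} → Cycle D → Vertex D → Set
CycleVerts C x = ∃ λ i → vtx C i ≡ x

CycleArcs : ∀ {D} → Cycle D → Vertex D → Vertex D → Set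
CycleArcs C x y = ∃ λ i → x ≡ vtx C i × y ≡ vtx C (next i)

DeleteCycleArcs : (D : Digraph) → Cycle D → Vertex D → Vertex D → Set
DeleteCycleArcs D C x y = Arc D x y × ¬ CycleArcs C x y

-- Subdigraphs and strong components of a digraph given by an arc relation R
-- on vertex type V.  A subdigraph is a vertex predicate S with an arc
-- predicate B.

IsSubdigraph : {V : Set} → (V → V → Set) → (V → Set) → (V → V → Set) → Set
IsSubdigraph R S B = ∀ x y → B x y → R x y × S x × S y

IsStrongSub : {V : Set} → (V → Set) → (V → V → Set) → Set
IsStrongSub S B = ∀ x y → S x → S y → Path B x y

IsStrongComponent : {V : Set} → (V → V → Set) → (V → Set) → (V → V → Set) → Set₁
IsStrongComponent {V} R S B =
  IsSubdigraph R S B × IsStrongSub S B ×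
  (∀ (S' : V → Set) (B' : V → V → Set) →
     IsSubdigraph R S' B' → IsStrongSub S' B' →
     (∀ x → S x → S' x) → (∀ x y → B x y → B' x y) →
     (∀ x → S' x → S x) × (∀ x y → B' x y → B x y))

{-# OPTIONS --safe #-}
-- Suppose C were a strong component of D'.  Call position i of C an exit if some
-- walk avoiding the arcs of C leads from C i to Cq, and an entry if some such walk
-- leads from Cq to C i.  An exit at i and an entry at i + 1 would make the arc
-- C i → C (i + 1) transitive, via a detour around Cq (whose arcs are not arcs of C,
-- as C lies in D').  Every position is an exit or an entry: either C i lies on Cq,
-- or, being non-linear, it has an arc to some w other than its successor on C or
-- from some w other than its predecessor; a path of D closing the loop through w
-- must meet Cq before meeting C, since otherwise that arc would lie in the strong
-- component C of D'.  Strong connectivity of D provides one exit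
-- and one entry; exits then propagate around C, so the position before the entry
-- is an exit, and the arc into the entry is transitive.
module Submission where

open import Defs

open import Data.Nat using (ℕ; zero; suc; _+_; _∸_; _%_; NonZero)
open import Data.Nat.Properties using (+-assoc; +-comm; +-identityʳ; +-suc; <⇒≤; m+[n∸m]≡n)
open import Data.Nat.DivMod using (%-distribˡ-+; m%n%n≡m%n; [m+n]%n≡m%n; m<n⇒m%n≡m)
open import Data.Fin as Fin using (Fin; toℕ)
open import Data.Fin.Properties using (toℕ-fromℕ<; toℕ-injective; toℕ<n; 0≢1+n; suc-injective; any?)
open import Data.Bool using (true; T; T?)
open import Data.Bool.Properties using (T-≡)
open import Data.List using (length; filter; tabulate)
open import Data.List.Properties using (filter-accept; filter-reject; filter-none)
open import Data.List.Membership.Propositional using (_∈_)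
open import Data.List.Relation.Unary.All using ([])
open import Data.List.Relation.Unary.All.Properties using (¬Any⇒All¬; tabulate⁺)
open import Data.List.Relation.Unary.Any using (here; there)
open import Data.List.Relation.Unary.AllPairs using ([]; _∷_)
open import Data.List.Relation.Unary.Unique.Propositional using (Unique)
open import Data.Product using (∃; ∃-syntax; _×_; _,_; proj₁; proj₂; map₂)
open import Data.Sum using (_⊎_; inj₁; inj₂; [_,_]′)
open import Data.Empty using (⊥-elim)
open import Function using (_∘_; id; Equivalence)
open import Relation.Binary.Definitions using (DecidableEquality)
open import Relation.Binary.PropositionalEquality
open import Relation.Nullary using (¬_; yes; no; _×-dec_; _⊎-dec_; ¬?)
open import Relation.Nullary.Decidable using (decidable-stable)
open import Relation.Unary using (Decidable)
import Data.Bool as Bool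

SourceOutside : {V : Set} → (V → V → Set) → (V → Set) → V → V → Set
SourceOutside R T x y = R x y × ¬ T x

TargetOutside : {V : Set} → (V → V → Set) → (V → Set) → V → V → Set
TargetOutside R T x y = R x y × ¬ T y

module _ {V : Set} {R : V → V → Set} where

  infixr 5 _++ʷ_

  _++ʷ_ : ∀ {a b c} → Walk R a b → Walk R b c → Walk R a c
  []      ++ʷ W′ = W′
  (e ∷ W) ++ʷ W′ = e ∷ (W ++ʷ W′)

  mapʷ : ∀ {R′ : V → V → Set} → (∀ {x y} → R x y → R′ x y) → ∀ {a b} → Walk R a b → Walk R′ a b
  mapʷ f []      = []
  mapʷ f (e ∷ W) = f e ∷ mapʷ f W

  module _ (_≟_ : DecidableEquality V) where
    open import Data.List.Membership.DecPropositional _≟_ using (_∈?_)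

    suffix-path : ∀ {a b x} (W : Walk R a b) → Unique (verts W) → x ∈ verts W → Path R x b
    suffix-path []      W!        (here refl) = [] , W!
    suffix-path (e ∷ W) W!        (here refl) = (e ∷ W) , W!
    suffix-path (_ ∷ W) (_ ∷ W!)  (there x∈W) = suffix-path W W! x∈W

    walk⇒path : ∀ {a b} → Walk R a b → Path R a b
    walk⇒path []      = [] , ([] ∷ [])
    walk⇒path {a} (e ∷ W) with walk⇒path W
    ... | P , P! with a ∈? verts P
    ...   | yes a∈P = suffix-path P P! a∈P
    ...   | no  a∉P = (e ∷ P) , (¬Any⇒All¬ _ a∉P ∷ P!)

  module _ {T : V → Set} (T? : Decidable T) where

    first-hit : ∀ {a b} → Walk R a b → T b → ∃[ x ] T x × Walk (SourceOutside R T) a x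
    first-hit {a} W b∈T with T? a
    first-hit W       b∈T | yes a∈T = _ , a∈T , []
    first-hit []      b∈T | no  a∉T = ⊥-elim (a∉T b∈T)
    first-hit (e ∷ W) b∈T | no  a∉T = map₂ (map₂ ((e , a∉T) ∷_)) (first-hit W b∈T)

    last-hit : ∀ {a b} → T a → Walk R a b → ∃[ y ] T y × Walk (TargetOutside R T) y b
    last-hit a∈T W = [ (λ W′ → _ , a∈T , W′) , id ]′ (avoid-or-hit W)
      where
      avoid-or-hit : ∀ {a b} → Walk R a b → Walk (TargetOutside R T) a b ⊎ ∃[ y ] T y × Walk (TargetOutside R T) y b
      avoid-or-hit [] = inj₁ []
      avoid-or-hit (_∷_ {v = c} e W) with avoid-or-hit W | T? c
      ... | inj₂ hit | _       = inj₂ hit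
      ... | inj₁ W′  | yes c∈T = inj₂ (c , c∈T , W′)
      ... | inj₁ W′  | no  c∉T = inj₁ ((e , c∉T) ∷ W′)

module _ {V : Set} {R : V → V → Set} where

  ComponentOf : V → V → Set
  ComponentOf s v = Walk R s v × Walk R v s

  ComponentArcOf : V → V → V → Set
  ComponentArcOf s u v = R u v × ComponentOf s u × ComponentOf s v

  componentOf-walk : ∀ {s a b} → ComponentOf s a → Walk R a b → ComponentOf s b →
                     Walk (ComponentArcOf s) a b
  componentOf-walk a∈ []      b∈ = []
  componentOf-walk {s} a∈ (_∷_ {v = c} e W) b∈ = (e , a∈ , c∈) ∷ componentOf-walk c∈ W b∈
    where
    c∈ : ComponentOf s c
    c∈ = proj₁ a∈ ++ʷ (e ∷ []) , W ++ʷ proj₂ b∈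

  module _ (_≟_ : DecidableEquality V) where

    componentOf-strong : ∀ s → IsStrongSub (ComponentOf s) (ComponentArcOf s)
    componentOf-strong s u v u∈ v∈ = walk⇒path _≟_ (componentOf-walk u∈ (proj₂ u∈ ++ʷ proj₁ v∈) v∈)

    -- The component of s contains (S, B), so maximality makes them equal.
    strongComponent-absorbs : ∀ {S B s t x y} → IsStrongComponent R S B → S s → S t →
                              Walk R s x → R x y → Walk R y t → B x y
    strongComponent-absorbs {S} {B} {s} {t} {x} {y} (sub , strong , maximal) s∈S t∈S s⇝x x→y y⇝t =
      proj₂ (maximal (ComponentOf s) (ComponentArcOf s) (λ _ _ → id) (componentOf-strong s)
                     S⊆component B⊆component)
            _ _ (x→y , (s⇝x , x→y ∷ y⇝s) , (s⇝x ++ʷ (x→y ∷ []) , y⇝s))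
      where
      within : ∀ {u v} → S u → S v → Walk R u v
      within u∈S v∈S = mapʷ (λ {a} {b} e → proj₁ (sub a b e)) (proj₁ (strong _ _ u∈S v∈S))

      y⇝s : Walk R y s
      y⇝s = y⇝t ++ʷ within t∈S s∈S

      S⊆component : ∀ v → S v → ComponentOf s v
      S⊆component v v∈S = within s∈S v∈S , within v∈S s∈S

      B⊆component : ∀ u v → B u v → ComponentArcOf s u v
      B⊆component u v e with sub u v e
      ... | u→v , u∈S , v∈S = u→v , S⊆component u u∈S , S⊆component v v∈S

module _ {A : Set} {P : A → Set} (P? : Decidable P) where

  length-filter-tabulate-unique : ∀ {k} (g : Fin k → A) (s : Fin k) → P (g s) →
                                  (∀ x → P (g x) → x ≡ s) → length (filter P? (tabulate g)) ≡ 1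
  length-filter-tabulate-unique g Fin.zero P-s unique = begin
    length (filter P? (tabulate g))                     ≡⟨ cong length (filter-accept P? P-s) ⟩
    suc (length (filter P? (tabulate (g ∘ Fin.suc))))   ≡⟨ cong (suc ∘ length) (filter-none P? (tabulate⁺ others)) ⟩
    1                                                   ∎
    where
    open ≡-Reasoning
    others : ∀ x → ¬ P (g (Fin.suc x))
    others x P-x = 0≢1+n (sym (unique (Fin.suc x) P-x))
  length-filter-tabulate-unique g (Fin.suc s) P-s unique =
    trans (cong length (filter-reject P? (0≢1+n ∘ unique Fin.zero)))
          (length-filter-tabulate-unique (g ∘ Fin.suc) s P-s (λ x → suc-injective ∘ unique (Fin.suc x)))

module _ (D : Digraph) where

  outdeg≡1 : ∀ {u v} → Arc D u v → (∀ w → Arc D u w → w ≡ v) → outdeg D u ≡ 1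
  outdeg≡1 {u} {v} u→v unique =
    length-filter-tabulate-unique {P = λ w → T (adj D u w)} (T? ∘ adj D u) id v
      (Equivalence.from T-≡ u→v) (λ w → unique w ∘ Equivalence.to T-≡)

  indeg≡1 : ∀ {u v} → Arc D v u → (∀ w → Arc D w u → w ≡ v) → indeg D u ≡ 1
  indeg≡1 {u} {v} v→u unique =
    length-filter-tabulate-unique {P = λ w → T (adj D w u)} (T? ∘ λ w → adj D w u) id v
      (Equivalence.from T-≡ v→u) (λ w → unique w ∘ Equivalence.to T-≡)

  nonlinear⇒extra-arc : ∀ {u⁻ u u⁺} → Arc D u⁻ u → Arc D u u⁺ → ¬ Linear D u →
                        (∃[ w ] Arc D u w × w ≢ u⁺) ⊎ (∃[ w ] Arc D w u × w ≢ u⁻)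
  nonlinear⇒extra-arc {u⁻} {u} {u⁺} u⁻→u u→u⁺ nonlinear
    with any? (λ w → (adj D u w Bool.≟ true) ×-dec ¬? (w Fin.≟ u⁺))
       | any? (λ w → (adj D w u Bool.≟ true) ×-dec ¬? (w Fin.≟ u⁻))
  ... | yes out    | _         = inj₁ out
  ... | no _       | yes into  = inj₂ into
  ... | no no-out  | no no-in  =
    ⊥-elim (nonlinear (indeg≡1 u⁻→u (only no-in) , outdeg≡1 u→u⁺ (only no-out)))
    where
    only : ∀ {v} {Q : Vertex D → Set} → ¬ (∃[ w ] Q w × w ≢ v) → ∀ w → Q w → w ≡ v
    only {v} none w q = decidable-stable (w Fin.≟ v) (λ w≢v → none (w , q , w≢v))

suc[m%n]%n≡suc[m]%n : ∀ m n .{{_ : NonZero n}} → suc (m % n) % n ≡ suc m % n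
suc[m%n]%n≡suc[m]%n m n = begin
  (1 + m % n) % n           ≡⟨ %-distribˡ-+ 1 (m % n) n ⟩
  (1 % n + m % n % n) % n   ≡⟨ cong (λ r → (1 % n + r) % n) (m%n%n≡m%n m n) ⟩
  (1 % n + m % n) % n       ≡⟨ %-distribˡ-+ 1 m n ⟨
  (1 + m) % n               ∎
  where open ≡-Reasoning

module _ {m : ℕ} where

  next^ : ℕ → Fin (suc m) → Fin (suc m)
  next^ zero    i = i
  next^ (suc t) i = next (next^ t i)

  toℕ-next^ : ∀ t i → toℕ (next^ t i) ≡ (toℕ i + t) % suc m
  toℕ-next^ zero    i = sym (trans (cong (_% suc m) (+-identityʳ (toℕ i))) (m<n⇒m%n≡m (toℕ<n i)))
  toℕ-next^ (suc t) i = begin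
    toℕ (next (next^ t i))              ≡⟨ toℕ-fromℕ< _ ⟩
    suc (toℕ (next^ t i)) % suc m       ≡⟨ cong (λ r → suc r % suc m) (toℕ-next^ t i) ⟩
    suc ((toℕ i + t) % suc m) % suc m   ≡⟨ suc[m%n]%n≡suc[m]%n (toℕ i + t) (suc m) ⟩
    suc (toℕ i + t) % suc m             ≡⟨ cong (_% suc m) (+-suc (toℕ i) t) ⟨
    (toℕ i + suc t) % suc m             ∎
    where open ≡-Reasoning

  next^-period : ∀ i → next^ (suc m) i ≡ i
  next^-period i = toℕ-injective (begin
    toℕ (next^ (suc m) i)     ≡⟨ toℕ-next^ (suc m) i ⟩
    (toℕ i + suc m) % suc m   ≡⟨ [m+n]%n≡m%n (toℕ i) (suc m) ⟩
    toℕ i % suc m             ≡⟨ m<n⇒m%n≡m (toℕ<n i) ⟩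
    toℕ i                     ∎)
    where open ≡-Reasoning

  next^-reaches : ∀ i j → ∃[ t ] next^ t i ≡ j
  next^-reaches i j = suc m ∸ toℕ i + toℕ j , toℕ-injective (begin
    toℕ (next^ (suc m ∸ toℕ i + toℕ j) i)         ≡⟨ toℕ-next^ _ i ⟩
    (toℕ i + (suc m ∸ toℕ i + toℕ j)) % suc m     ≡⟨ cong (_% suc m) (+-assoc (toℕ i) _ (toℕ j)) ⟨
    (toℕ i + (suc m ∸ toℕ i) + toℕ j) % suc m     ≡⟨ cong (λ r → (r + toℕ j) % suc m) (m+[n∸m]≡n (<⇒≤ (toℕ<n i))) ⟩
    (suc m + toℕ j) % suc m                       ≡⟨ cong (_% suc m) (+-comm (suc m) (toℕ j)) ⟩
    (toℕ j + suc m) % suc m                       ≡⟨ [m+n]%n≡m%n (toℕ j) (suc m) ⟩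
    toℕ j % suc m                                 ≡⟨ m<n⇒m%n≡m (toℕ<n j) ⟩
    toℕ j                                         ∎)
    where open ≡-Reasoning

  next-surjective : ∀ j → ∃[ i ] next i ≡ j
  next-surjective j = next^ m j , next^-period j

  next^-next : ∀ t i → next^ t (next i) ≡ next (next^ t i)
  next^-next zero    i = refl
  next^-next (suc t) i = cong next (next^-next t i)

  next-injective : ∀ {i j} → next i ≡ next j → i ≡ j
  next-injective {i} {j} eq = begin
    i                    ≡⟨ next^-period i ⟨
    next (next^ m i)     ≡⟨ next^-next m i ⟨
    next^ m (next i)     ≡⟨ cong (next^ m) eq ⟩
    next^ m (next j)     ≡⟨ next^-next m j ⟩
    next (next^ m j)     ≡⟨ next^-period j ⟩
    j                    ∎
    where open ≡-Reasoning

  cyclic-induction : ∀ (P : Fin (suc m) → Set) {i} → P i → (∀ j → P j → P (next j)) → ∀ j → P j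
  cyclic-induction P {i} P-i step j with next^-reaches i j
  ... | t , refl = along t
    where
    along : ∀ t → P (next^ t i)
    along zero    = P-i
    along (suc t) = step _ (along t)

  cyclic-walk : ∀ {V : Set} {R : V → V → Set} (f : Fin (suc m) → V) →
                (∀ i → R (f i) (f (next i))) → ∀ i j → Walk R (f i) (f j)
  cyclic-walk {R = R} f step i =
    cyclic-induction (λ j → Walk R (f i) (f j)) [] (λ j W → W ++ʷ (step j ∷ []))

module _ {D : Digraph} (Z : Cycle D) where

  cycleVerts? : Decidable (CycleVerts Z)
  cycleVerts? x = any? (λ i → vtx Z i Fin.≟ x)

  cycleArc-source : ∀ {x y} → CycleArcs Z x y → CycleVerts Z x
  cycleArc-source (i , x≡ , _) = i , sym x≡

  cycleArc-target : ∀ {x y} → CycleArcs Z x y → CycleVerts Z y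
  cycleArc-target (i , _ , y≡) = next i , sym y≡

  cycleArc-out-unique : ∀ {i y} → CycleArcs Z (vtx Z i) y → y ≡ vtx Z (next i)
  cycleArc-out-unique (j , x≡ , y≡) = trans y≡ (cong (vtx Z ∘ next) (sym (vtxInj Z x≡)))

  cycleArc-in-unique : ∀ {i x} → CycleArcs Z x (vtx Z (next i)) → x ≡ vtx Z i
  cycleArc-in-unique (j , x≡ , y≡) = trans x≡ (cong (vtx Z) (sym (next-injective (vtxInj Z y≡))))

module CycleAsComponent (D : Digraph) (minimal : MinimalStrong D) (Cq C : Cycle D)
         (component : IsStrongComponent (DeleteCycleArcs D Cq) (CycleVerts C) (CycleArcs C)) where

  private
    D′ : Vertex D → Vertex D → Set
    D′ = DeleteCycleArcs D Cq

    D∖C : Vertex D → Vertex D → Set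
    D∖C = DeleteCycleArcs D C

    walk : ∀ u v → Walk (Arc D) u v
    walk u v = proj₁ (proj₁ minimal u v)

    OnCycles : Vertex D → Set
    OnCycles x = CycleVerts Cq x ⊎ CycleVerts C x

    onCycles? : Decidable OnCycles
    onCycles? x = cycleVerts? Cq x ⊎-dec cycleVerts? C x

    source-off⇒D′ : ∀ {a b} → Walk (SourceOutside (Arc D) OnCycles) a b → Walk D′ a b
    source-off⇒D′ = mapʷ (map₂ λ off → off ∘ inj₁ ∘ cycleArc-source Cq)

    source-off⇒D∖C : ∀ {a b} → Walk (SourceOutside (Arc D) OnCycles) a b → Walk D∖C a b
    source-off⇒D∖C = mapʷ (map₂ λ off → off ∘ inj₂ ∘ cycleArc-source C)

    target-off⇒D′ : ∀ {a b} → Walk (TargetOutside (Arc D) OnCycles) a b → Walk D′ a b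
    target-off⇒D′ = mapʷ (map₂ λ off → off ∘ inj₁ ∘ cycleArc-target Cq)

    target-off⇒D∖C : ∀ {a b} → Walk (TargetOutside (Arc D) OnCycles) a b → Walk D∖C a b
    target-off⇒D∖C = mapʷ (map₂ λ off → off ∘ inj₂ ∘ cycleArc-target C)

    C⊆D′ : ∀ {x y} → CycleArcs C x y → D′ x y
    C⊆D′ {x} {y} = proj₁ ∘ proj₁ component x y

    absorbed : ∀ i j {x y} → Walk D′ (vtx C i) x → D′ x y → Walk D′ y (vtx C j) → CycleArcs C x y
    absorbed i j = strongComponent-absorbs Fin._≟_ component (i , refl) (j , refl)

  Exit : Fin (len C) → Set
  Exit i = ∃[ c ] Walk D∖C (vtx C i) (vtx Cq c)

  Entry : Fin (len C) → Set
  Entry i = ∃[ c ] Walk D∖C (vtx Cq c) (vtx C i)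

  Cq-walk : ∀ c c′ → Walk D∖C (vtx Cq c) (vtx Cq c′)
  Cq-walk = cyclic-walk (vtx Cq) (λ c → arcs Cq c , λ c∈C → proj₂ (C⊆D′ c∈C) (c , refl , refl))

  exit-entry⇒transitive : ∀ i → Exit i → Entry (next i) → TransitiveArc D (vtx C i) (vtx C (next i))
  exit-entry⇒transitive i (c , to-Cq) (c′ , from-Cq) =
    arcs C i , walk⇒path Fin._≟_ (mapʷ avoid (to-Cq ++ʷ Cq-walk c c′ ++ʷ from-Cq))
    where
    avoid : ∀ {x y} → D∖C x y → ArcWithout D (vtx C i) (vtx C (next i)) x y
    avoid (x→y , ∉C) = x→y , λ { (refl , refl) → ∉C (i , refl , refl) }

  exists-exit : ∃ Exit
  exists-exit with last-hit (cycleVerts? C) (Fin.zero , refl) (walk (vtx C Fin.zero) (vtx Cq Fin.zero))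
  ... | _ , (j , refl) , W = j , Fin.zero , mapʷ (map₂ (_∘ cycleArc-target C)) W

  exists-entry : ∃ Entry
  exists-entry with first-hit (cycleVerts? C) (walk (vtx Cq Fin.zero) (vtx C Fin.zero)) (Fin.zero , refl)
  ... | _ , (j , refl) , W = j , Fin.zero , mapʷ (map₂ (_∘ cycleArc-source C)) W

  -- Returning to C i from w, the walk reaches Cq before C, for otherwise C i → w
  -- would be an arc of the strong component C.
  exit-via-arc : ∀ {i w} → ¬ CycleVerts Cq (vtx C i) → Arc D (vtx C i) w → w ≢ vtx C (next i) → Exit i
  exit-via-arc {i} {w} u∉Cq u→w w≢u⁺ with first-hit onCycles? (walk w (vtx C i)) (inj₂ (i , refl))
  ... | _ , inj₁ (c , refl) , W = c , (u→w , w≢u⁺ ∘ cycleArc-out-unique C) ∷ source-off⇒D∖C W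
  ... | _ , inj₂ (j , refl) , W = ⊥-elim (w≢u⁺ (cycleArc-out-unique C u→w∈C))
    where
    u→w∈C : CycleArcs C (vtx C i) w
    u→w∈C = absorbed i j [] (u→w , u∉Cq ∘ cycleArc-source Cq) (source-off⇒D′ W)

  entry-via-arc : ∀ {i w} → ¬ CycleVerts Cq (vtx C (next i)) → Arc D w (vtx C (next i)) → w ≢ vtx C i →
                  Entry (next i)
  entry-via-arc {i} {w} u∉Cq w→u w≢u⁻ with last-hit onCycles? (inj₂ (next i , refl)) (walk (vtx C (next i)) w)
  ... | _ , inj₁ (c , refl) , W = c , target-off⇒D∖C W ++ʷ (w→u , w≢u⁻ ∘ cycleArc-in-unique C) ∷ []
  ... | _ , inj₂ (j , refl) , W = ⊥-elim (w≢u⁻ (cycleArc-in-unique C w→u∈C))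
    where
    w→u∈C : CycleArcs C w (vtx C (next i))
    w→u∈C = absorbed j (next i) (target-off⇒D′ W) (w→u , u∉Cq ∘ cycleArc-target Cq) []

  module _ (nonlinear : ∀ i → ¬ Linear D (vtx C i)) where

    exit-or-entry : ∀ i → Exit (next i) ⊎ Entry (next i)
    exit-or-entry i with cycleVerts? Cq (vtx C (next i))
    ... | yes (c , on-Cq) = inj₁ (c , subst (Walk D∖C _) (sym on-Cq) [])
    ... | no  u∉Cq with nonlinear⇒extra-arc D (arcs C i) (arcs C (next i)) (nonlinear (next i))
    ...   | inj₁ (w , u→w , w≢u⁺) = inj₁ (exit-via-arc u∉Cq u→w w≢u⁺)
    ...   | inj₂ (w , w→u , w≢u⁻) = inj₂ (entry-via-arc u∉Cq w→u w≢u⁻)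

    exit-next : ∀ i → Exit i → Exit (next i)
    exit-next i exit with exit-or-entry i
    ... | inj₁ exit′ = exit′
    ... | inj₂ entry = ⊥-elim (proj₂ minimal _ _ (exit-entry⇒transitive i exit entry))

lemma4 : (D : Digraph) → MinimalStrong D → (Cq : Cycle D) → (C : Cycle D) →
         (∀ i → ¬ Linear D (vtx C i)) →
         ¬ IsStrongComponent (DeleteCycleArcs D Cq) (CycleVerts C) (CycleArcs C)
lemma4 D minimal Cq C nonlinear component = no-entry (proj₁ exists-entry) (proj₂ exists-entry)
  where
  open CycleAsComponent D minimal Cq C component

  exit-everywhere : ∀ i → Exit i
  exit-everywhere = cyclic-induction Exit (proj₂ exists-exit) (exit-next nonlinear)

  no-entry : ∀ j → ¬ Entry j
  no-entry j entry with next-surjective j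
  ... | i , refl = proj₂ minimal _ _ (exit-entry⇒transitive i (exit-everywhere i) entry)
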